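{- Let $k \geq 3$ be an integer, let $H$ be a $k$-regular graph with $n$ vertices and chromatic index $c$, and let $\{H_0,\ldots,H_{c-1}\}$ be an equitable matching decomposition of $H$. Let $\{X_0,\ldots, X_{c-1}\}$ be an $(x,w)$-semipartition with respect to $\{H_0,\dots,H_{c-1}\}$, for nonnegative integers $x,w$. If $w\leq \frac32 x$ and $x+2y\leq \lfloor |E(H)|/c\rfloor$ where $y=\lceil 3x-\frac32 w\rceil$, then there exists an $(x,w)$-partition $\{X_i,Y_i,Z_i:i\in\mathbb{Z}_c\}$ of $H$ in which $X_i\cup Y_i\cup Z_i=E(H_i)$ for each $i$.
   Context: All graphs are finite and simple; two edges are adjacent if they share a vertex. A matching decomposition of $H$ is a set of edge-disjoint matchings partitioning $E(H)$; it is equitable if any two of its matchings differ in size by at most one. Given $X_i\subseteq E(H_i)$ for $i\in\mathbb{Z}_c$, a vertex $v$ is $i$-covered for $\{X_0,\dots,X_{c-1}\}$ if $v$ is incident with an edge of $X_i$ and either $v$ is incident with an edge of $X_{i+1}$ or no edge of $H_{i+1}$ is incident with $v$ (indices mod $c$). An $(x,w)$-semipartition with respect to $\{H_0,\dots,H_{c-1}\}$ is a family $\{X_0,\dots,X_{c-1}\}$ with $X_i\subseteq E(H_i)$, $|X_i|=x$, and, for every $i$, at least $w$ vertices $i$-covered for $\{X_0,\dots,X_{c-1}\}$. An $(x,w)$-partition of $H$ is a partition $\{X_i,Y_i,Z_i:i\in\mathbb{Z}_c\}$ of $E(H)$ (with specified roles) such that: (P1) $w\leq\frac32 x$ and $x+2y\leq\lfloor|E(H)|/c\rfloor$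 with $y=\lceil 3x-\frac32 w\rceil$; (P2) $\{H_i'\}$ is an equitable matching decomposition of $H$, where $H_i'$ has edge set $X_i\cup Y_i\cup Z_i$; (P3) $|X_i|=x$, $|Y_i|=y$ for all $i$; (P4) no edge of $X_i$ is adjacent to an edge of $Z_{i+1}$; (P5) $|Y_i'|\leq y/3$ and each edge of $Y_i'$ is adjacent to at most one edge of $Z_{i+1}$, where $Y_i'$ is the set of edges of $Y_i$ adjacent to exactly two edges of $X_{i-1}$; (P6) for all $i$, at least $w$ vertices are $i$-covered for $\{X_0,\dots,X_{c-1}\}$ (with respect to the decomposition $\{H_i'\}$). -}

module Defs where

open import Data.Nat using (ℕ; zero; suc; _+_; _*_; _∸_; _≤_; _<_; ⌈_/2⌉)
open import Data.Nat.DivMod using (_/_; _%_; m%n<n)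
open import Data.Fin using (Fin; toℕ; fromℕ<) renaming (_≟_ to _≟ᶠ_)
open import Data.Fin.Properties using (any?)
open import Data.Fin.Subset using (Subset; _∈_; _⊆_; _∩_; _∪_; ∣_∣; Empty)
open import Data.Fin.Subset.Properties using (_∈?_)
open import Data.Vec using (tabulate)
open import Data.Bool using (_∧_)
open import Data.Product using (Σ; ∃; _×_; _,_; proj₁; proj₂)
open import Data.Sum using (_⊎_)
open import Relation.Nullary using (¬_; Dec; does; ¬?)
open import Relation.Nullary.Decidable using (_⊎-dec_; _×-dec_)
open import Relation.Binary.PropositionalEquality using (_≡_; _≢_)

-- Finite simple graphs: vertex set Fin n, edge set Fin m (so |E(H)| = m),
-- each edge has two distinct endpoints, no two edges have the same
-- (unordered) pair of endpoints.

SameEnds : ∀ {n} → Fin n × Fin n → Fin n × Fin n → Set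
SameEnds (a , b) (c , d) = (a ≡ c × b ≡ d) ⊎ (a ≡ d × b ≡ c)

record Graph (n m : ℕ) : Set where
  field
    ends     : Fin m → Fin n × Fin n
    loopless : ∀ e → proj₁ (ends e) ≢ proj₂ (ends e)
    simple   : ∀ e f → SameEnds (ends e) (ends f) → e ≡ f

module _ {n m : ℕ} (G : Graph n m) where
  open Graph G

  Incident : Fin n → Fin m → Set
  Incident v e = v ≡ proj₁ (ends e) ⊎ v ≡ proj₂ (ends e)

  incident? : ∀ v e → Dec (Incident v e)
  incident? v e = (v ≟ᶠ proj₁ (ends e)) ⊎-dec (v ≟ᶠ proj₂ (ends e))

  Adjacent : Fin m → Fin m → Set
  Adjacent e f = e ≢ f × ∃ λ v → Incident v e × Incident v f

  adjacent? : ∀ e f → Dec (Adjacent e f)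
  adjacent? e f = ¬? (e ≟ᶠ f) ×-dec any? (λ v → incident? v e ×-dec incident? v f)

  incSet : Fin n → Subset m
  incSet v = tabulate (λ e → does (incident? v e))

  degree : Fin n → ℕ
  degree v = ∣ incSet v ∣

  Regular : ℕ → Set
  Regular k = ∀ v → degree v ≡ k

  adjSet : Fin m → Subset m
  adjSet e = tabulate (λ f → does (adjacent? e f))

  IsMatching : Subset m → Set
  IsMatching S = ∀ e f → e ∈ S → f ∈ S → ¬ Adjacent e f

  ProperEdgeColouring : ℕ → Set
  ProperEdgeColouring c = Σ (Fin m → Fin c) λ col → ∀ e f → Adjacent e f → col e ≢ col f

  ChromaticIndex : ℕ → Set
  ChromaticIndex c = ProperEdgeColouring c × (∀ c' → c' < c → ¬ ProperEdgeColouring c')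

  IsMatchingDecomposition : ∀ {c} → (Fin c → Subset m) → Set
  IsMatchingDecomposition {c} D =
    (∀ e → ∃ λ i → e ∈ D i)
    × (∀ i j e → e ∈ D i → e ∈ D j → i ≡ j)
    × (∀ i → IsMatching (D i))

  IsEquitableMatchingDecomposition : ∀ {c} → (Fin c → Subset m) → Set
  IsEquitableMatchingDecomposition D =
    IsMatchingDecomposition D × (∀ i j → ∣ D i ∣ ≤ ∣ D j ∣ + 1)

sucMod : ∀ {c} → Fin c → Fin c
sucMod {suc c} i = fromℕ< (m%n<n (suc (toℕ i)) (suc c))

predMod : ∀ {c} → Fin c → Fin c
predMod {suc c} i = fromℕ< (m%n<n (toℕ i + c) (suc c))

-- ⌊ m / c ⌋ ; only ever used with c ≥ 1 (c = 0 forces the graph to be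
-- edgeless and Z_c empty); set to 0 when c = 0.
floorDiv : ℕ → ℕ → ℕ
floorDiv m zero    = 0
floorDiv m (suc c) = m / suc c

-- y = ⌈ 3x - (3/2) w ⌉ = ⌈ (6x - 3w) / 2 ⌉ (valid when 2w ≤ 3x)
yOf : ℕ → ℕ → ℕ
yOf x w = ⌈ (6 * x ∸ 3 * w) /2⌉

module _ {n m : ℕ} (G : Graph n m) {c : ℕ} where

  Covered : (D : Fin c → Subset m) (X : Fin c → Subset m) → Fin c → Fin n → Set
  Covered D X i v =
    (∃ λ e → e ∈ X i × Incident G v e)
    × ((∃ λ e → e ∈ X (sucMod i) × Incident G v e)
       ⊎ (∀ e → e ∈ D (sucMod i) → ¬ Incident G v e))

  AtLeastCovered : (D : Fin c → Subset m) (X : Fin c → Subset m) → Fin c → ℕ → Set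
  AtLeastCovered D X i w =
    Σ (Subset n) λ S → w ≤ ∣ S ∣ × (∀ v → v ∈ S → Covered D X i v)

  IsSemipartition : (D X : Fin c → Subset m) → ℕ → ℕ → Set
  IsSemipartition D X x w =
    (∀ i → X i ⊆ D i) × (∀ i → ∣ X i ∣ ≡ x) × (∀ i → AtLeastCovered D X i w)

  Y′ : (X Y : Fin c → Subset m) → Fin c → Subset m
  Y′ X Y i = tabulate λ e →
    does (e ∈? Y i) ∧ does (∣ X (predMod i) ∩ adjSet G e ∣ ≟ⁿ 2)
    where open Data.Nat using () renaming (_≟_ to _≟ⁿ_)

  H′ : (X Y Z : Fin c → Subset m) → Fin c → Subset m
  H′ X Y Z i = X i ∪ Y i ∪ Z i

  IsPartition : (X Y Z : Fin c → Subset m) → ℕ → ℕ → Set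
  IsPartition X Y Z x w =
    ( (∀ e → ∃ λ i → e ∈ X i ⊎ e ∈ Y i ⊎ e ∈ Z i)
    × (∀ i j e → e ∈ X i → e ∈ X j → i ≡ j)
    × (∀ i j e → e ∈ Y i → e ∈ Y j → i ≡ j)
    × (∀ i j e → e ∈ Z i → e ∈ Z j → i ≡ j)
    × (∀ i j e → e ∈ X i → e ∈ Y j → ⊥′)
    × (∀ i j e → e ∈ X i → e ∈ Z j → ⊥′)
    × (∀ i j e → e ∈ Y i → e ∈ Z j → ⊥′) )
    × (2 * w ≤ 3 * x × x + 2 * yOf x w ≤ floorDiv m c)
    × IsEquitableMatchingDecomposition G (H′ X Y Z)
    × (∀ i → ∣ X i ∣ ≡ x × ∣ Y i ∣ ≡ yOf x w)
    × (∀ i e f → e ∈ X i → f ∈ Z (sucMod i) → ¬ Adjacent G e f)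
    × (∀ i → 3 * ∣ Y′ X Y i ∣ ≤ yOf x w
         × (∀ e → e ∈ Y′ X Y i → ∣ Z (sucMod i) ∩ adjSet G e ∣ ≤ 1))
    × (∀ i → AtLeastCovered (H′ X Y Z) X i w)
    where open import Data.Empty renaming (⊥ to ⊥′)

module Submission where

-- Put into Y (i+1) every edge of R (i+1) = H (i+1) ∖ X (i+1) that must avoid Z (i+1): by (P4)
-- those meeting V(X i), and by (P5) those meeting the first end of an edge of B i, the edges
-- of R i with two X (i-1)-neighbours; then pad Y (i+1) to size y inside R (i+1) and let
-- Z (i+1) be the rest.  Since H (i+1) is a matching, the forced edges inject into the vertices
-- they meet.  No i-covered vertex meets R (i+1), so the first kind meet V(X i) only in the at
-- most 2x - w vertices that are not i-covered.  An edge of B i has both ends in V(X (i-1)),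
-- neither (i-1)-covered, so 2 |B i| ≤ 2x - w.  Hence (2x - w) + |B i| ≤ 3x - 3w/2 ≤ y and
-- 3 |B i| ≤ y, while equitability and x + 2y ≤ ⌊|E|/c⌋ leave room: |R (i+1)| ≥ y.

open import Defs
open import Data.Nat using (ℕ; _≤_; _*_; _+_)
open import Data.Fin using (Fin)
open import Data.Fin.Subset using (Subset)
open import Data.Product using (Σ; _×_)
open import Relation.Binary.PropositionalEquality using (_≡_)

open import Data.Bool using (true; false; T)
open import Data.Empty using (⊥; ⊥-elim)
open import Data.Fin using (zero; suc; toℕ) renaming (_≟_ to _≟ᶠ_)
open import Data.Fin.Properties using (any?; ¬Fin0; 0≢1+n; suc-injective; toℕ-injective; toℕ-fromℕ<; toℕ<n)
open import Data.Fin.Subset using (_∈_; _∉_; _⊆_; _∩_; _∪_; _─_; _-_; ∣_∣; ⁅_⁆; ⊤; Nonempty) renaming (⊥ to ∅)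
open import Data.Fin.Subset.Properties
  using ( _∈?_; drop-there; ∉⊥; x∈⁅x⁆; x∈⁅y⁆⇒x≡y; Empty-unique; x∈p∪q⁺; x∈p∪q⁻; x∈p∩q⁻
        ; p⊆p∪q; p─q⊆p; x∈p∧x∉q⇒x∈p─q; x∈p∧x≢y⇒x∈p-y; x∈p⇒∣p-x∣<∣p∣
        ; ∣⊥∣≡0; ∣⊤∣≡n; ∣⁅x⁆∣≡1; p⊆q⇒∣p∣≤∣q∣)
open import Data.Nat using (zero; suc; _∸_; z≤n; s≤s; ⌈_/2⌉; NonZero) renaming (_≟_ to _≟ⁿ_)
open import Data.Nat.Properties hiding (suc-injective; 0≢1+n)
open import Data.Nat.DivMod using (_%_; _/_; m%n<n; m%n%n≡m%n; %-distribˡ-+; [m+n]%n≡m%n; m<n⇒m%n≡m; /-monoˡ-≤; m*n/n≡m)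
open import Data.Nat.Tactic.RingSolver using (solve-∀)
open import Data.Product using (∃; _,_; proj₁; proj₂)
open import Data.Sum using (_⊎_; inj₁; inj₂; [_,_]′; map₂)
open import Data.Vec using ([]; _∷_; tabulate; here; there)
open import Data.Vec.Properties using (lookup∘tabulate; lookup⇒[]=; []=⇒lookup)
open import Function using (_∘_)
open import Relation.Nullary using (¬_; Dec; yes; no; does)
open import Relation.Nullary.Decidable using (dec-true; isYes≗does; toWitness; _×-dec_)
open import Relation.Binary.PropositionalEquality using (refl; sym; trans; cong; subst; subst₂; module ≡-Reasoning)

private
  variable
    a b : ℕ

decSubset : {P : Fin a → Set} → (∀ x → Dec (P x)) → Subset a
decSubset P? = tabulate (does ∘ P?)

∈-decSubset⁺ : {P : Fin a → Set} (P? : ∀ x → Dec (P x)) {x : Fin a} → P x → x ∈ decSubset P?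
∈-decSubset⁺ P? {x} px = lookup⇒[]= x _ (trans (lookup∘tabulate _ x) (dec-true (P? x) px))

∈-decSubset⁻ : {P : Fin a → Set} (P? : ∀ x → Dec (P x)) {x : Fin a} → x ∈ decSubset P? → P x
∈-decSubset⁻ P? {x} x∈ =
  toWitness {a? = P? x} (subst T (sym (trans (isYes≗does (P? x)) does≡true)) _)
  where
  does≡true : does (P? x) ≡ true
  does≡true = trans (sym (lookup∘tabulate _ x)) ([]=⇒lookup x∈)

x∈p─q⇒x∉q : {p q : Subset a} {x : Fin a} → x ∈ p ─ q → x ∉ q
x∈p─q⇒x∉q {p = _ ∷ p} {true ∷ q}  (there x∈) (there x∈q) = x∈p─q⇒x∉q x∈ x∈q
x∈p─q⇒x∉q {p = _ ∷ p} {false ∷ q} (there x∈) (there x∈q) = x∈p─q⇒x∉q x∈ x∈q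

p⊆q∪[p─q] : (p q : Subset a) → p ⊆ q ∪ (p ─ q)
p⊆q∪[p─q] p q {x} x∈p with x ∈? q
... | yes x∈q = x∈p∪q⁺ (inj₁ x∈q)
... | no  x∉q = x∈p∪q⁺ (inj₂ (x∈p∧x∉q⇒x∈p─q x∈p x∉q))

p⊆q⇒p∪[q─p]≡q : {p q : Subset a} → p ⊆ q → p ∪ (q ─ p) ≡ q
p⊆q⇒p∪[q─p]≡q {p = []}        {[]}      _   = refl
p⊆q⇒p∪[q─p]≡q {p = true ∷ p}  {true ∷ q} p⊆q =
  cong (true ∷_) (p⊆q⇒p∪[q─p]≡q (drop-there ∘ p⊆q ∘ there))
p⊆q⇒p∪[q─p]≡q {p = true ∷ p}  {false ∷ q} p⊆q with p⊆q here
... | ()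
p⊆q⇒p∪[q─p]≡q {p = false ∷ p} {s ∷ q}    p⊆q =
  cong (s ∷_) (p⊆q⇒p∪[q─p]≡q (drop-there ∘ p⊆q ∘ there))

∣p∪q∣≤∣p∣+∣q∣ : (p q : Subset a) → ∣ p ∪ q ∣ ≤ ∣ p ∣ + ∣ q ∣
∣p∪q∣≤∣p∣+∣q∣ []          []          = z≤n
∣p∪q∣≤∣p∣+∣q∣ (true ∷ p)  (true ∷ q)  = s≤s (≤-trans (∣p∪q∣≤∣p∣+∣q∣ p q) (+-monoʳ-≤ ∣ p ∣ (n≤1+n _)))
∣p∪q∣≤∣p∣+∣q∣ (true ∷ p)  (false ∷ q) = s≤s (∣p∪q∣≤∣p∣+∣q∣ p q)
∣p∪q∣≤∣p∣+∣q∣ (false ∷ p) (true ∷ q)  = ≤-trans (s≤s (∣p∪q∣≤∣p∣+∣q∣ p q)) (≤-reflexive (sym (+-suc ∣ p ∣ ∣ q ∣)))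
∣p∪q∣≤∣p∣+∣q∣ (false ∷ p) (false ∷ q) = ∣p∪q∣≤∣p∣+∣q∣ p q

∣p∪q∣≡∣p∣+∣q∣ : (p q : Subset a) → (∀ {x} → x ∈ p → x ∉ q) → ∣ p ∪ q ∣ ≡ ∣ p ∣ + ∣ q ∣
∣p∪q∣≡∣p∣+∣q∣ []          []          _       = refl
∣p∪q∣≡∣p∣+∣q∣ (true ∷ p)  (true ∷ q)  p∩q=∅ = ⊥-elim (p∩q=∅ here here)
∣p∪q∣≡∣p∣+∣q∣ (true ∷ p)  (false ∷ q) p∩q=∅ =
  cong suc (∣p∪q∣≡∣p∣+∣q∣ p q λ x∈p x∈q → p∩q=∅ (there x∈p) (there x∈q))
∣p∪q∣≡∣p∣+∣q∣ (false ∷ p) (true ∷ q)  p∩q=∅ =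
  trans (cong suc (∣p∪q∣≡∣p∣+∣q∣ p q λ x∈p x∈q → p∩q=∅ (there x∈p) (there x∈q))) (sym (+-suc ∣ p ∣ ∣ q ∣))
∣p∪q∣≡∣p∣+∣q∣ (false ∷ p) (false ∷ q) p∩q=∅ =
  ∣p∪q∣≡∣p∣+∣q∣ p q λ x∈p x∈q → p∩q=∅ (there x∈p) (there x∈q)

∣p─q∣+∣q∣≡∣p∣ : {p q : Subset a} → q ⊆ p → ∣ p ─ q ∣ + ∣ q ∣ ≡ ∣ p ∣
∣p─q∣+∣q∣≡∣p∣ {p = p} {q} q⊆p = begin
  ∣ p ─ q ∣ + ∣ q ∣   ≡⟨ +-comm ∣ p ─ q ∣ ∣ q ∣ ⟩
  ∣ q ∣ + ∣ p ─ q ∣   ≡⟨ ∣p∪q∣≡∣p∣+∣q∣ q (p ─ q) (λ x∈q x∈p─q → x∈p─q⇒x∉q x∈p─q x∈q) ⟨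
  ∣ q ∪ (p ─ q) ∣     ≡⟨ cong ∣_∣ (p⊆q⇒p∪[q─p]≡q q⊆p) ⟩
  ∣ p ∣               ∎
  where open ≡-Reasoning

injection⇒∣p∣≤∣q∣ : {p : Subset a} {q : Subset b} (f : ∀ {x} → x ∈ p → Fin b)
  → (∀ {x} (x∈p : x ∈ p) → f x∈p ∈ q)
  → (∀ {x y} (x∈p : x ∈ p) (y∈p : y ∈ p) → f x∈p ≡ f y∈p → x ≡ y)
  → ∣ p ∣ ≤ ∣ q ∣
injection⇒∣p∣≤∣q∣ {p = []}        f into inj = z≤n
injection⇒∣p∣≤∣q∣ {p = false ∷ p} f into inj =
  injection⇒∣p∣≤∣q∣ (f ∘ there) (into ∘ there) λ x∈p y∈p → suc-injective ∘ inj (there x∈p) (there y∈p)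
injection⇒∣p∣≤∣q∣ {p = true ∷ p} {q} f into inj =
  ≤-trans (s≤s (injection⇒∣p∣≤∣q∣ (f ∘ there) into-rest λ x∈p y∈p → suc-injective ∘ inj (there x∈p) (there y∈p)))
          (x∈p⇒∣p-x∣<∣p∣ (into here))
  where
  into-rest : ∀ {x} (x∈p : x ∈ p) → f (there x∈p) ∈ q - f here
  into-rest x∈p = x∈p∧x≢y⇒x∈p-y (into (there x∈p)) λ eq → 0≢1+n (inj here (there x∈p) (sym eq))

Empty⇒∣p∣≡0 : {p : Subset a} → ¬ Nonempty p → ∣ p ∣ ≡ 0
Empty⇒∣p∣≡0 {a} p-empty = trans (cong ∣_∣ (Empty-unique p-empty)) (∣⊥∣≡0 a)

all-equal⇒∣p∣≤1 : {p : Subset a} → (∀ {x y} → x ∈ p → y ∈ p → x ≡ y) → ∣ p ∣ ≤ 1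
all-equal⇒∣p∣≤1 {p = []}        _      = z≤n
all-equal⇒∣p∣≤1 {p = false ∷ p} all-eq =
  all-equal⇒∣p∣≤1 λ x∈p y∈p → suc-injective (all-eq (there x∈p) (there y∈p))
all-equal⇒∣p∣≤1 {p = true ∷ p}  all-eq =
  s≤s (≤-reflexive (Empty⇒∣p∣≡0 p-empty))
  where
  p-empty : ¬ Nonempty p
  p-empty (_ , x∈p) = 0≢1+n (all-eq here (there x∈p))

∃-subset-of-size : (p : Subset a) (k : ℕ) → k ≤ ∣ p ∣ → ∃ λ q → q ⊆ p × ∣ q ∣ ≡ k
∃-subset-of-size []          zero    _ = [] , (λ ()) , refl
∃-subset-of-size (false ∷ p) k       k≤ =
  let q , q⊆p , ∣q∣ = ∃-subset-of-size p k k≤ in false ∷ q , (λ { (there x∈q) → there (q⊆p x∈q) }) , ∣q∣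
∃-subset-of-size (true ∷ p)  zero    _ =
  let q , q⊆p , ∣q∣ = ∃-subset-of-size p zero z≤n in false ∷ q , (λ { (there x∈q) → there (q⊆p x∈q) }) , ∣q∣
∃-subset-of-size (true ∷ p)  (suc k) (s≤s k≤) =
  let q , q⊆p , ∣q∣ = ∃-subset-of-size p k k≤
  in true ∷ q , (λ { here → here ; (there x∈q) → there (q⊆p x∈q) }) , cong suc ∣q∣

⊆-extend : {p r : Subset a} {k : ℕ} → p ⊆ r → ∣ p ∣ ≤ k → k ≤ ∣ r ∣
  → ∃ λ q → p ⊆ q × q ⊆ r × ∣ q ∣ ≡ k
⊆-extend {p = p} {r} {k} p⊆r ∣p∣≤k k≤∣r∣ =
  p ∪ t , p⊆p∪q t , p∪t⊆r , ∣p∪t∣≡k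
  where
  k∸∣p∣≤ : k ∸ ∣ p ∣ ≤ ∣ r ─ p ∣
  k∸∣p∣≤ = m≤n+o⇒m∸n≤o k ∣ p ∣
    (subst (k ≤_) (trans (sym (∣p─q∣+∣q∣≡∣p∣ p⊆r)) (+-comm ∣ r ─ p ∣ ∣ p ∣)) k≤∣r∣)
  t = proj₁ (∃-subset-of-size (r ─ p) (k ∸ ∣ p ∣) k∸∣p∣≤)
  t⊆r─p = proj₁ (proj₂ (∃-subset-of-size (r ─ p) (k ∸ ∣ p ∣) k∸∣p∣≤))
  ∣t∣ = proj₂ (proj₂ (∃-subset-of-size (r ─ p) (k ∸ ∣ p ∣) k∸∣p∣≤))
  p∪t⊆r : p ∪ t ⊆ r
  p∪t⊆r x∈ = [ p⊆r , p─q⊆p r p ∘ t⊆r─p ]′ (x∈p∪q⁻ p t x∈)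
  ∣p∪t∣≡k : ∣ p ∪ t ∣ ≡ k
  ∣p∪t∣≡k = begin
    ∣ p ∪ t ∣         ≡⟨ ∣p∪q∣≡∣p∣+∣q∣ p t (λ x∈p x∈t → x∈p─q⇒x∉q (t⊆r─p x∈t) x∈p) ⟩
    ∣ p ∣ + ∣ t ∣     ≡⟨ cong (∣ p ∣ +_) ∣t∣ ⟩
    ∣ p ∣ + (k ∸ ∣ p ∣) ≡⟨ m+[n∸m]≡n ∣p∣≤k ⟩
    k                 ∎
    where open ≡-Reasoning

covered⇒∣p∣≤c*b : ∀ c {F : Fin c → Subset a} {b} (p : Subset a)
  → (∀ i → ∣ F i ∣ ≤ b) → (∀ {e} → e ∈ p → ∃ λ i → e ∈ F i) → ∣ p ∣ ≤ c * b
covered⇒∣p∣≤c*b zero    p _ cover =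
  ≤-reflexive (Empty⇒∣p∣≡0 λ (_ , e∈p) → ¬Fin0 (proj₁ (cover e∈p)))
covered⇒∣p∣≤c*b (suc c) {F} {b} p ∣F∣≤b cover = begin
  ∣ p ∣                       ≤⟨ p⊆q⇒∣p∣≤∣q∣ (p⊆q∪[p─q] p (F zero)) ⟩
  ∣ F zero ∪ (p ─ F zero) ∣   ≤⟨ ∣p∪q∣≤∣p∣+∣q∣ (F zero) (p ─ F zero) ⟩
  ∣ F zero ∣ + ∣ p ─ F zero ∣ ≤⟨ +-mono-≤ (∣F∣≤b zero) (covered⇒∣p∣≤c*b c (p ─ F zero) (∣F∣≤b ∘ suc) cover-rest) ⟩
  b + c * b                   ∎
  where
  open ≤-Reasoning
  cover-rest : ∀ {e} → e ∈ p ─ F zero → ∃ λ i → e ∈ F (suc i)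
  cover-rest e∈ with cover (p─q⊆p p (F zero) e∈)
  ... | zero  , e∈F₀ = ⊥-elim (x∈p─q⇒x∉q e∈ e∈F₀)
  ... | suc i , e∈Fᵢ = i , e∈Fᵢ

image : (Fin a → Fin b) → Subset a → Subset b
image f []          = ∅
image f (true ∷ p)  = ⁅ f zero ⁆ ∪ image (f ∘ suc) p
image f (false ∷ p) = image (f ∘ suc) p

∈-image⁺ : (f : Fin a → Fin b) {p : Subset a} {x : Fin a} → x ∈ p → f x ∈ image f p
∈-image⁺ f {true ∷ p}  here        = x∈p∪q⁺ (inj₁ (x∈⁅x⁆ (f zero)))
∈-image⁺ f {true ∷ p}  (there x∈p) = x∈p∪q⁺ (inj₂ (∈-image⁺ (f ∘ suc) x∈p))
∈-image⁺ f {false ∷ p} (there x∈p) = ∈-image⁺ (f ∘ suc) x∈p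

∈-image⁻ : (f : Fin a → Fin b) {p : Subset a} {y : Fin b} → y ∈ image f p → ∃ λ x → x ∈ p × f x ≡ y
∈-image⁻ f {[]}        y∈ = ⊥-elim (∉⊥ y∈)
∈-image⁻ f {true ∷ p}  y∈ with x∈p∪q⁻ ⁅ f zero ⁆ (image (f ∘ suc) p) y∈
... | inj₁ y∈⁅⁆ = zero , here , sym (x∈⁅y⁆⇒x≡y (f zero) y∈⁅⁆)
... | inj₂ y∈′  = let x , x∈p , fx≡y = ∈-image⁻ (f ∘ suc) y∈′ in suc x , there x∈p , fx≡y
∈-image⁻ f {false ∷ p} y∈ = let x , x∈p , fx≡y = ∈-image⁻ (f ∘ suc) y∈ in suc x , there x∈p , fx≡y

∣image∣≤∣p∣ : (f : Fin a → Fin b) (p : Subset a) → ∣ image f p ∣ ≤ ∣ p ∣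
∣image∣≤∣p∣ {b = b} f []  = ≤-reflexive (∣⊥∣≡0 b)
∣image∣≤∣p∣ f (true ∷ p)  =
  ≤-trans (∣p∪q∣≤∣p∣+∣q∣ ⁅ f zero ⁆ _) (+-mono-≤ (≤-reflexive (∣⁅x⁆∣≡1 (f zero))) (∣image∣≤∣p∣ (f ∘ suc) p))
∣image∣≤∣p∣ f (false ∷ p) = ∣image∣≤∣p∣ (f ∘ suc) p

injective⇒∣p∣≤∣image∣ : (f : Fin a → Fin b) {p : Subset a}
  → (∀ {x y} → x ∈ p → y ∈ p → f x ≡ f y → x ≡ y) → ∣ p ∣ ≤ ∣ image f p ∣
injective⇒∣p∣≤∣image∣ f = injection⇒∣p∣≤∣q∣ (λ {x} _ → f x) (∈-image⁺ f)

m%n+o : ∀ m o n .{{_ : NonZero n}} → (m % n + o) % n ≡ (m + o) % n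
m%n+o m o n = begin
  (m % n + o) % n           ≡⟨ %-distribˡ-+ (m % n) o n ⟩
  (m % n % n + o % n) % n   ≡⟨ cong (λ r → (r + o % n) % n) (m%n%n≡m%n m n) ⟩
  (m % n + o % n) % n       ≡⟨ %-distribˡ-+ m o n ⟨
  (m + o) % n               ∎
  where open ≡-Reasoning

toℕ[i+n]%n≡toℕi : ∀ {c} (i : Fin (suc c)) → (toℕ i + suc c) % suc c ≡ toℕ i
toℕ[i+n]%n≡toℕi {c} i = trans ([m+n]%n≡m%n (toℕ i) (suc c)) (m<n⇒m%n≡m (toℕ<n i))

sucMod-predMod : ∀ {c} (i : Fin c) → sucMod (predMod i) ≡ i
sucMod-predMod {suc c} i = toℕ-injective (begin
  toℕ (sucMod (predMod i))              ≡⟨ toℕ-fromℕ< _ ⟩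
  suc (toℕ (predMod i)) % suc c         ≡⟨ cong (λ r → suc r % suc c) (toℕ-fromℕ< (m%n<n (toℕ i + c) (suc c))) ⟩
  suc ((toℕ i + c) % suc c) % suc c     ≡⟨ cong (_% suc c) (+-comm 1 _) ⟩
  ((toℕ i + c) % suc c + 1) % suc c     ≡⟨ m%n+o (toℕ i + c) 1 (suc c) ⟩
  (toℕ i + c + 1) % suc c               ≡⟨ cong (_% suc c) (trans (+-assoc (toℕ i) c 1) (cong (toℕ i +_) (+-comm c 1))) ⟩
  (toℕ i + suc c) % suc c               ≡⟨ toℕ[i+n]%n≡toℕi i ⟩
  toℕ i                                 ∎)
  where open ≡-Reasoning

predMod-sucMod : ∀ {c} (i : Fin c) → predMod (sucMod i) ≡ i
predMod-sucMod {suc c} i = toℕ-injective (begin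
  toℕ (predMod (sucMod i))              ≡⟨ toℕ-fromℕ< _ ⟩
  (toℕ (sucMod i) + c) % suc c          ≡⟨ cong (λ r → (r + c) % suc c) (toℕ-fromℕ< (m%n<n (suc (toℕ i)) (suc c))) ⟩
  (suc (toℕ i) % suc c + c) % suc c     ≡⟨ m%n+o (suc (toℕ i)) c (suc c) ⟩
  (suc (toℕ i) + c) % suc c             ≡⟨ cong (_% suc c) (sym (+-suc (toℕ i) c)) ⟩
  (toℕ i + suc c) % suc c               ≡⟨ toℕ[i+n]%n≡toℕi i ⟩
  toℕ i                                 ∎)
  where open ≡-Reasoning

t+t+3w≤6x⇒t≤yOf : ∀ t x w → t + t + 3 * w ≤ 6 * x → t ≤ yOf x w
t+t+3w≤6x⇒t≤yOf t x w h = begin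
  t                      ≡⟨ n≡⌈n+n/2⌉ t ⟩
  ⌈ t + t /2⌉            ≤⟨ ⌈n/2⌉-mono (m+n≤o⇒m≤o∸n (t + t) h) ⟩
  ⌈ 6 * x ∸ 3 * w /2⌉    ∎
  where open ≤-Reasoning

-- In the construction a, b, s, s′ are |V(X i) ∖ S i|, |B i|, |S i| and |S (i-1)|.
yOf-bounds : ∀ a b s s′ x w → a + s ≤ 2 * x → 2 * b + s′ ≤ 2 * x → w ≤ s → w ≤ s′
  → a + b ≤ yOf x w × 3 * b ≤ yOf x w
yOf-bounds a b s s′ x w a+s≤ 2b+s′≤ w≤s w≤s′ =
  t+t+3w≤6x⇒t≤yOf (a + b) x w (begin
    (a + b) + (a + b) + 3 * w          ≤⟨ +-monoʳ-≤ ((a + b) + (a + b)) (3w≤2s+s′) ⟩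
    (a + b) + (a + b) + (2 * s + s′)   ≡⟨ regroup a b s s′ ⟩
    2 * (a + s) + (2 * b + s′)         ≤⟨ +-mono-≤ (*-monoʳ-≤ 2 a+s≤) 2b+s′≤ ⟩
    2 * (2 * x) + 2 * x                ≡⟨ 2[2x]+2x≡6x x ⟩
    6 * x                              ∎)
  , t+t+3w≤6x⇒t≤yOf (3 * b) x w (begin
    3 * b + 3 * b + 3 * w              ≤⟨ +-monoʳ-≤ (3 * b + 3 * b) (*-monoʳ-≤ 3 w≤s′) ⟩
    3 * b + 3 * b + 3 * s′             ≡⟨ 3b+3b+3s≡3[2b+s] b s′ ⟩
    3 * (2 * b + s′)                   ≤⟨ *-monoʳ-≤ 3 2b+s′≤ ⟩
    3 * (2 * x)                        ≡⟨ 3[2x]≡6x x ⟩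
    6 * x                              ∎)
  where
  open ≤-Reasoning
  3w≡2w+w : ∀ w → 3 * w ≡ 2 * w + w
  3w≡2w+w = solve-∀
  regroup : ∀ a b s s′ → (a + b) + (a + b) + (2 * s + s′) ≡ 2 * (a + s) + (2 * b + s′)
  regroup = solve-∀
  2[2x]+2x≡6x : ∀ x → 2 * (2 * x) + 2 * x ≡ 6 * x
  2[2x]+2x≡6x = solve-∀
  3b+3b+3s≡3[2b+s] : ∀ b s′ → 3 * b + 3 * b + 3 * s′ ≡ 3 * (2 * b + s′)
  3b+3b+3s≡3[2b+s] = solve-∀
  3[2x]≡6x : ∀ x → 3 * (2 * x) ≡ 6 * x
  3[2x]≡6x = solve-∀
  3w≤2s+s′ : 3 * w ≤ 2 * s + s′
  3w≤2s+s′ = ≤-trans (≤-reflexive (3w≡2w+w w)) (+-mono-≤ (*-monoʳ-≤ 2 w≤s) w≤s′)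

2*y≤1+r⇒y≤r : ∀ y r → 2 * y ≤ suc r → y ≤ r
2*y≤1+r⇒y≤r zero    r _       = z≤n
2*y≤1+r⇒y≤r (suc y) r (s≤s h) = subst (_≤ r) (cong suc (+-identityʳ y)) (m+n≤o⇒n≤o y h)

module _ {n m : ℕ} (G : Graph n m) where
  open Graph G

  end₁ end₂ : Fin m → Fin n
  end₁ = proj₁ ∘ ends
  end₂ = proj₂ ∘ ends

  other-end : ∀ {v e} → Incident G v e → ∃ λ u → ∀ t → Incident G t e → t ≡ v ⊎ t ≡ u
  other-end (inj₁ refl) = end₂ _ , λ t t∈e → t∈e
  other-end (inj₂ refl) = end₁ _ , λ t t∈e → [ inj₂ , inj₁ ]′ t∈e

  matching-incident-unique : ∀ {M e f v} → IsMatching G M → e ∈ M → f ∈ M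
    → Incident G v e → Incident G v f → e ≡ f
  matching-incident-unique {e = e} {f} {v} M-matching e∈M f∈M v∈e v∈f with e ≟ᶠ f
  ... | yes e≡f = e≡f
  ... | no  e≢f = ⊥-elim (M-matching e f e∈M f∈M (e≢f , v , v∈e , v∈f))

  endpoints : Subset m → Subset n
  endpoints M = image end₁ M ∪ image end₂ M

  ∈-endpoints⁺ : ∀ {M e v} → e ∈ M → Incident G v e → v ∈ endpoints M
  ∈-endpoints⁺ e∈M (inj₁ refl) = x∈p∪q⁺ (inj₁ (∈-image⁺ end₁ e∈M))
  ∈-endpoints⁺ e∈M (inj₂ refl) = x∈p∪q⁺ (inj₂ (∈-image⁺ end₂ e∈M))

  ∈-endpoints⁻ : ∀ {M v} → v ∈ endpoints M → ∃ λ e → e ∈ M × Incident G v e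
  ∈-endpoints⁻ {M} v∈ with x∈p∪q⁻ (image end₁ M) (image end₂ M) v∈
  ... | inj₁ v∈₁ = let e , e∈M , eq = ∈-image⁻ end₁ v∈₁ in e , e∈M , inj₁ (sym eq)
  ... | inj₂ v∈₂ = let e , e∈M , eq = ∈-image⁻ end₂ v∈₂ in e , e∈M , inj₂ (sym eq)

  ∣endpoints∣≤2∣M∣ : ∀ M → ∣ endpoints M ∣ ≤ 2 * ∣ M ∣
  ∣endpoints∣≤2∣M∣ M = begin
    ∣ endpoints M ∣                           ≤⟨ ∣p∪q∣≤∣p∣+∣q∣ (image end₁ M) (image end₂ M) ⟩
    ∣ image end₁ M ∣ + ∣ image end₂ M ∣       ≤⟨ +-mono-≤ (∣image∣≤∣p∣ end₁ M) (∣image∣≤∣p∣ end₂ M) ⟩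
    ∣ M ∣ + ∣ M ∣                             ≡⟨ cong (∣ M ∣ +_) (+-identityʳ ∣ M ∣) ⟨
    2 * ∣ M ∣                                 ∎
    where open ≤-Reasoning

  matching⇒2∣M∣≤∣endpoints∣ : ∀ {M} → IsMatching G M → 2 * ∣ M ∣ ≤ ∣ endpoints M ∣
  matching⇒2∣M∣≤∣endpoints∣ {M} M-matching = begin
    2 * ∣ M ∣                              ≡⟨ cong (∣ M ∣ +_) (+-identityʳ ∣ M ∣) ⟩
    ∣ M ∣ + ∣ M ∣                          ≤⟨ +-mono-≤ (injective⇒∣p∣≤∣image∣ end₁ λ e∈M f∈M eq →
                                                         matching-incident-unique M-matching e∈M f∈M (inj₁ refl) (inj₁ eq))
                                                      (injective⇒∣p∣≤∣image∣ end₂ λ e∈M f∈M eq →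
                                                         matching-incident-unique M-matching e∈M f∈M (inj₂ refl) (inj₂ eq)) ⟩
    ∣ image end₁ M ∣ + ∣ image end₂ M ∣    ≡⟨ ∣p∪q∣≡∣p∣+∣q∣ (image end₁ M) (image end₂ M) ends-disjoint ⟨
    ∣ endpoints M ∣                        ∎
    where
    open ≤-Reasoning
    ends-disjoint : ∀ {v} → v ∈ image end₁ M → v ∉ image end₂ M
    ends-disjoint v∈₁ v∈₂ =
      let e , e∈M , e₁≡v = ∈-image⁻ end₁ v∈₁
          f , f∈M , f₂≡v = ∈-image⁻ end₂ v∈₂
          e≡f = matching-incident-unique M-matching e∈M f∈M (inj₁ (sym e₁≡v)) (inj₂ (sym f₂≡v))
      in loopless e (trans e₁≡v (trans (sym f₂≡v) (cong end₂ (sym e≡f))))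

  two-neighbours⇒∈endpoints : ∀ {M e v} → IsMatching G M → ∣ M ∩ adjSet G e ∣ ≡ 2
    → Incident G v e → v ∈ endpoints M
  two-neighbours⇒∈endpoints {M} {e} {v} M-matching two v∈e with v ∈? endpoints M
  ... | yes v∈ = v∈
  ... | no  v∉ = ⊥-elim (2≰1 (subst (_≤ 1) two (all-equal⇒∣p∣≤1 λ a∈ b∈ →
          matching-incident-unique M-matching (proj₁ (at-u a∈)) (proj₁ (at-u b∈)) (proj₂ (at-u a∈)) (proj₂ (at-u b∈)))))
    where
    2≰1 : ¬ 2 ≤ 1
    2≰1 (s≤s ())
    u = proj₁ (other-end v∈e)
    at-u : ∀ {a} → a ∈ M ∩ adjSet G e → a ∈ M × Incident G u a
    at-u {a} a∈ with x∈p∩q⁻ M (adjSet G e) a∈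
    ... | a∈M , a-adj with ∈-decSubset⁻ (adjacent? G e) a-adj
    ...   | _ , t , t∈e , t∈a with proj₂ (other-end v∈e) t t∈e
    ...     | inj₁ refl = ⊥-elim (v∉ (∈-endpoints⁺ a∈M t∈a))
    ...     | inj₂ refl = a∈M , t∈a

  touching : Subset m → Subset n → Subset m
  touching M W = decSubset (λ f → (f ∈? M) ×-dec any? (λ v → (v ∈? W) ×-dec incident? G v f))

  ∈-touching⁺ : ∀ {M W f v} → f ∈ M → v ∈ W → Incident G v f → f ∈ touching M W
  ∈-touching⁺ {M} {W} f∈M v∈W v∈f = ∈-decSubset⁺ (λ f → (f ∈? M) ×-dec any? (λ v → (v ∈? W) ×-dec incident? G v f))
    (f∈M , _ , v∈W , v∈f)

  ∈-touching⁻ : ∀ {M W f} → f ∈ touching M W → f ∈ M × ∃ λ v → v ∈ W × Incident G v f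
  ∈-touching⁻ {M} {W} = ∈-decSubset⁻ (λ f → (f ∈? M) ×-dec any? (λ v → (v ∈? W) ×-dec incident? G v f))

  matching⇒∣touching∣≤∣W∣ : ∀ {M} W → IsMatching G M → ∣ touching M W ∣ ≤ ∣ W ∣
  matching⇒∣touching∣≤∣W∣ {M} W M-matching = injection⇒∣p∣≤∣q∣
    (λ f∈ → proj₁ (proj₂ (∈-touching⁻ f∈)))
    (λ f∈ → proj₁ (proj₂ (proj₂ (∈-touching⁻ f∈))))
    λ f∈ f′∈ v≡v′ → matching-incident-unique M-matching (proj₁ (∈-touching⁻ f∈)) (proj₁ (∈-touching⁻ f′∈))
      (subst (λ v → Incident G v _) v≡v′ (proj₂ (proj₂ (proj₂ (∈-touching⁻ f∈)))))
      (proj₂ (proj₂ (proj₂ (∈-touching⁻ f′∈))))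

  equitable-resp-≗ : ∀ {c} {F F′ : Fin c → Subset m} → (∀ i → F i ≡ F′ i)
    → IsEquitableMatchingDecomposition G F′ → IsEquitableMatchingDecomposition G F
  equitable-resp-≗ {F = F} {F′} F≗F′ ((covers , disjoint , matching) , equitable) =
    ( (λ e → let i , e∈ = covers e in i , to⁻ i e∈)
    , (λ i j e e∈Fᵢ e∈Fⱼ → disjoint i j e (to i e∈Fᵢ) (to j e∈Fⱼ))
    , (λ i e f e∈ f∈ → matching i e f (to i e∈) (to i f∈)) )
    , λ i j → subst₂ (λ p q → ∣ p ∣ ≤ ∣ q ∣ + 1) (sym (F≗F′ i)) (sym (F≗F′ j)) (equitable i j)
    where
    to : ∀ i {e} → e ∈ F i → e ∈ F′ i
    to i {e} = subst (e ∈_) (F≗F′ i)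
    to⁻ : ∀ i {e} → e ∈ F′ i → e ∈ F i
    to⁻ i {e} = subst (e ∈_) (sym (F≗F′ i))

  -- m ≤ c (∣ D j ∣ + 1): the classes cover E(G) and none has more than ∣ D j ∣ + 1 edges.
  equitable⇒floorDiv≤∣D∣+1 : ∀ {c} {D : Fin c → Subset m} → IsEquitableMatchingDecomposition G D
    → ∀ j → floorDiv m c ≤ ∣ D j ∣ + 1
  equitable⇒floorDiv≤∣D∣+1 {suc c} {D} ((covers , _) , equitable) j = begin
    m / suc c                         ≤⟨ /-monoˡ-≤ (suc c) m≤ ⟩
    (∣ D j ∣ + 1) * suc c / suc c     ≡⟨ m*n/n≡m (∣ D j ∣ + 1) (suc c) ⟩
    ∣ D j ∣ + 1                       ∎
    where
    open ≤-Reasoning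
    m≤ : m ≤ (∣ D j ∣ + 1) * suc c
    m≤ = subst₂ _≤_ (∣⊤∣≡n m) (*-comm (suc c) _)
      (covered⇒∣p∣≤c*b (suc c) ⊤ (λ i → equitable i j) (λ {e} _ → covers e))

module Construction {n m c : ℕ} (G : Graph n m) (D X : Fin c → Subset m) (x w : ℕ)
  (D-equitable : IsEquitableMatchingDecomposition G D) (X-semi : IsSemipartition G D X x w)
  (x+2y≤⌊m/c⌋ : x + 2 * yOf x w ≤ floorDiv m c) where

  y : ℕ
  y = yOf x w

  D-covers : ∀ e → ∃ λ i → e ∈ D i
  D-covers = proj₁ (proj₁ D-equitable)

  D-disjoint : ∀ i j e → e ∈ D i → e ∈ D j → i ≡ j
  D-disjoint = proj₁ (proj₂ (proj₁ D-equitable))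

  D-matching : ∀ i → IsMatching G (D i)
  D-matching = proj₂ (proj₂ (proj₁ D-equitable))

  X⊆D : ∀ i → X i ⊆ D i
  X⊆D = proj₁ X-semi

  ∣X∣≡x : ∀ i → ∣ X i ∣ ≡ x
  ∣X∣≡x = proj₁ (proj₂ X-semi)

  X-matching : ∀ i → IsMatching G (X i)
  X-matching i e f e∈X f∈X = D-matching i e f (X⊆D i e∈X) (X⊆D i f∈X)

  S : Fin c → Subset n
  S i = proj₁ (proj₂ (proj₂ X-semi) i)

  w≤∣S∣ : ∀ i → w ≤ ∣ S i ∣
  w≤∣S∣ i = proj₁ (proj₂ (proj₂ (proj₂ X-semi) i))

  S-covered : ∀ i {v} → v ∈ S i → Covered G D X i v
  S-covered i = proj₂ (proj₂ (proj₂ (proj₂ X-semi) i)) _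

  R : Fin c → Subset m
  R j = D j ─ X j

  R⊆D : ∀ j → R j ⊆ D j
  R⊆D j = p─q⊆p (D j) (X j)

  R-matching : ∀ j → IsMatching G (R j)
  R-matching j e f e∈R f∈R = D-matching j e f (R⊆D j e∈R) (R⊆D j f∈R)

  S⊆endpoints : ∀ i → S i ⊆ endpoints G (X i)
  S⊆endpoints i v∈S = let _ , e∈X , v∈e = proj₁ (S-covered i v∈S) in ∈-endpoints⁺ G e∈X v∈e

  covered⇒¬incident : ∀ {i v f} → Covered G D X i v → f ∈ R (sucMod i) → ¬ Incident G v f
  covered⇒¬incident (_ , inj₁ (g , g∈X , v∈g)) f∈R v∈f = x∈p─q⇒x∉q f∈R
    (subst (_∈ X _) (matching-incident-unique G (D-matching _) (X⊆D _ g∈X) (R⊆D _ f∈R) v∈g v∈f) g∈X)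
  covered⇒¬incident (_ , inj₂ no-edge) f∈R v∈f = no-edge _ (R⊆D _ f∈R) v∈f

  B-member? : ∀ i e → Dec (e ∈ R i × ∣ X (predMod i) ∩ adjSet G e ∣ ≡ 2)
  B-member? i e = (e ∈? R i) ×-dec (∣ X (predMod i) ∩ adjSet G e ∣ ≟ⁿ 2)

  B : Fin c → Subset m
  B i = decSubset (B-member? i)

  B-matching : ∀ i → IsMatching G (B i)
  B-matching i e f e∈B f∈B =
    R-matching i e f (proj₁ (∈-decSubset⁻ (B-member? i) e∈B)) (proj₁ (∈-decSubset⁻ (B-member? i) f∈B))

  endpoints-B⊆ : ∀ i → endpoints G (B i) ⊆ endpoints G (X (predMod i)) ─ S (predMod i)
  endpoints-B⊆ i v∈ =
    let e , e∈B , v∈e = ∈-endpoints⁻ G v∈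
        e∈R , two = ∈-decSubset⁻ (B-member? i) e∈B
    in x∈p∧x∉q⇒x∈p─q (two-neighbours⇒∈endpoints G (X-matching (predMod i)) two v∈e)
         λ v∈S → covered⇒¬incident (S-covered _ v∈S) (subst (λ j → e ∈ R j) (sym (sucMod-predMod i)) e∈R) v∈e

  -- The vertices at which an edge of R (i+1) is forced into Y (i+1): those covered by X i
  -- but not i-covered, and the first ends of the edges of B i.
  W : Fin c → Subset n
  W i = (endpoints G (X i) ─ S i) ∪ image (end₁ G) (B i)

  Base : Fin c → Subset m
  Base i = touching G (R (sucMod i)) (W i)

  ∣endpoints─S∣+∣S∣≤2x : ∀ i → ∣ endpoints G (X i) ─ S i ∣ + ∣ S i ∣ ≤ 2 * x
  ∣endpoints─S∣+∣S∣≤2x i = begin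
    ∣ endpoints G (X i) ─ S i ∣ + ∣ S i ∣  ≡⟨ ∣p─q∣+∣q∣≡∣p∣ (S⊆endpoints i) ⟩
    ∣ endpoints G (X i) ∣                 ≤⟨ ∣endpoints∣≤2∣M∣ G (X i) ⟩
    2 * ∣ X i ∣                           ≡⟨ cong (2 *_) (∣X∣≡x i) ⟩
    2 * x                                 ∎
    where open ≤-Reasoning

  2∣B∣+∣S∣≤2x : ∀ i → 2 * ∣ B i ∣ + ∣ S (predMod i) ∣ ≤ 2 * x
  2∣B∣+∣S∣≤2x i = ≤-trans
    (+-monoˡ-≤ ∣ S (predMod i) ∣ (≤-trans (matching⇒2∣M∣≤∣endpoints∣ G (B-matching i)) (p⊆q⇒∣p∣≤∣q∣ (endpoints-B⊆ i))))
    (∣endpoints─S∣+∣S∣≤2x (predMod i))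

  ∣endpoints─S∣+∣B∣≤y×3∣B∣≤y : ∀ i → ∣ endpoints G (X i) ─ S i ∣ + ∣ B i ∣ ≤ y × 3 * ∣ B i ∣ ≤ y
  ∣endpoints─S∣+∣B∣≤y×3∣B∣≤y i = yOf-bounds _ _ _ _ x w (∣endpoints─S∣+∣S∣≤2x i) (2∣B∣+∣S∣≤2x i) (w≤∣S∣ i) (w≤∣S∣ (predMod i))

  ∣Base∣≤y : ∀ i → ∣ Base i ∣ ≤ y
  ∣Base∣≤y i = begin
    ∣ Base i ∣                                              ≤⟨ matching⇒∣touching∣≤∣W∣ G (W i) (R-matching (sucMod i)) ⟩
    ∣ W i ∣                                                 ≤⟨ ∣p∪q∣≤∣p∣+∣q∣ (endpoints G (X i) ─ S i) (image (end₁ G) (B i)) ⟩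
    ∣ endpoints G (X i) ─ S i ∣ + ∣ image (end₁ G) (B i) ∣  ≤⟨ +-monoʳ-≤ _ (∣image∣≤∣p∣ (end₁ G) (B i)) ⟩
    ∣ endpoints G (X i) ─ S i ∣ + ∣ B i ∣                   ≤⟨ proj₁ (∣endpoints─S∣+∣B∣≤y×3∣B∣≤y i) ⟩
    y                                                       ∎
    where open ≤-Reasoning

  y≤∣R∣ : ∀ j → y ≤ ∣ R j ∣
  y≤∣R∣ j = 2*y≤1+r⇒y≤r y ∣ R j ∣ (+-cancelˡ-≤ x (2 * y) (suc ∣ R j ∣) (begin
    x + 2 * y              ≤⟨ x+2y≤⌊m/c⌋ ⟩
    floorDiv m c           ≤⟨ equitable⇒floorDiv≤∣D∣+1 G D-equitable j ⟩
    ∣ D j ∣ + 1            ≡⟨ cong (_+ 1) (∣p─q∣+∣q∣≡∣p∣ (X⊆D j)) ⟨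
    ∣ R j ∣ + ∣ X j ∣ + 1  ≡⟨ cong (λ k → ∣ R j ∣ + k + 1) (∣X∣≡x j) ⟩
    ∣ R j ∣ + x + 1        ≡⟨ rearrange ∣ R j ∣ x ⟩
    x + suc ∣ R j ∣        ∎))
    where
    open ≤-Reasoning
    rearrange : ∀ r x → r + x + 1 ≡ x + suc r
    rearrange = solve-∀

  Base⊆R : ∀ j → Base (predMod j) ⊆ R j
  Base⊆R j f∈ = subst (λ k → _ ∈ R k) (sucMod-predMod j) (proj₁ (∈-touching⁻ G f∈))

  Y-choice : ∀ j → ∃ λ Yⱼ → Base (predMod j) ⊆ Yⱼ × Yⱼ ⊆ R j × ∣ Yⱼ ∣ ≡ y
  Y-choice j = ⊆-extend (Base⊆R j) (∣Base∣≤y (predMod j)) (y≤∣R∣ j)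

  Y : Fin c → Subset m
  Y j = proj₁ (Y-choice j)

  Z : Fin c → Subset m
  Z j = R j ─ Y j

  Y⊆R : ∀ j → Y j ⊆ R j
  Y⊆R j = proj₁ (proj₂ (proj₂ (Y-choice j)))

  ∣Y∣≡y : ∀ j → ∣ Y j ∣ ≡ y
  ∣Y∣≡y j = proj₂ (proj₂ (proj₂ (Y-choice j)))

  Base⊆Y : ∀ i → Base i ⊆ Y (sucMod i)
  Base⊆Y i f∈ = proj₁ (proj₂ (Y-choice (sucMod i))) (subst (λ k → _ ∈ Base k) (sym (predMod-sucMod i)) f∈)

  Z∌Base : ∀ i {f} → f ∈ Z (sucMod i) → f ∉ Base i
  Z∌Base i f∈Z f∈Base = x∈p─q⇒x∉q f∈Z (Base⊆Y i f∈Base)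

  H′≡D : ∀ i → H′ G X Y Z i ≡ D i
  H′≡D i = begin
    X i ∪ Y i ∪ (R i ─ Y i)  ≡⟨ cong (X i ∪_) (p⊆q⇒p∪[q─p]≡q (Y⊆R i)) ⟩
    X i ∪ (D i ─ X i)        ≡⟨ p⊆q⇒p∪[q─p]≡q (X⊆D i) ⟩
    D i                      ∎
    where open ≡-Reasoning

  Z⊆R : ∀ j → Z j ⊆ R j
  Z⊆R j = p─q⊆p (R j) (Y j)

  Y⊆D : ∀ j → Y j ⊆ D j
  Y⊆D j = R⊆D j ∘ Y⊆R j

  Z⊆D : ∀ j → Z j ⊆ D j
  Z⊆D j = R⊆D j ∘ Z⊆R j

  class-unique : {P : Fin c → Subset m} → (∀ i → P i ⊆ D i) → ∀ i j e → e ∈ P i → e ∈ P j → i ≡ j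
  class-unique P⊆D i j e e∈Pᵢ e∈Pⱼ = D-disjoint i j e (P⊆D i e∈Pᵢ) (P⊆D j e∈Pⱼ)

  classes-disjoint : {P Q : Fin c → Subset m} → (∀ i → P i ⊆ D i) → (∀ i → Q i ⊆ D i)
    → (∀ i {e} → e ∈ P i → e ∉ Q i) → ∀ i j e → e ∈ P i → e ∈ Q j → ⊥
  classes-disjoint {P} P⊆D Q⊆D P∩Q=∅ i j e e∈Pᵢ e∈Qⱼ =
    P∩Q=∅ j (subst (λ k → e ∈ P k) (D-disjoint i j e (P⊆D i e∈Pᵢ) (Q⊆D j e∈Qⱼ)) e∈Pᵢ) e∈Qⱼ

  X-Z-nonadjacent : ∀ i e f → e ∈ X i → f ∈ Z (sucMod i) → ¬ Adjacent G e f
  X-Z-nonadjacent i e f e∈X f∈Z (_ , v , v∈e , v∈f) = Z∌Base i f∈Z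
    (∈-touching⁺ G (Z⊆R _ f∈Z) (x∈p∪q⁺ (inj₁ (x∈p∧x∉q⇒x∈p─q (∈-endpoints⁺ G e∈X v∈e) v∉S))) v∈f)
    where
    v∉S : v ∉ S i
    v∉S v∈S = covered⇒¬incident (S-covered i v∈S) (Z⊆R _ f∈Z) v∈f

  Y′⊆B : ∀ i → Y′ G X Y i ⊆ B i
  Y′⊆B i e∈Y′ =
    let e∈Y , two = ∈-decSubset⁻ (λ e → (e ∈? Y i) ×-dec (∣ X (predMod i) ∩ adjSet G e ∣ ≟ⁿ 2)) e∈Y′
    in ∈-decSubset⁺ (B-member? i) (Y⊆R i e∈Y , two)

  -- Z-neighbours of e at its first end lie in Base i ⊆ Y (i+1), so they all meet e at its second end.
  Y′-Z-neighbours≤1 : ∀ i e → e ∈ Y′ G X Y i → ∣ Z (sucMod i) ∩ adjSet G e ∣ ≤ 1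
  Y′-Z-neighbours≤1 i e e∈Y′ = all-equal⇒∣p∣≤1 λ a∈ b∈ →
    matching-incident-unique G (R-matching (sucMod i)) (proj₁ (at-end₂ a∈)) (proj₁ (at-end₂ b∈))
      (proj₂ (at-end₂ a∈)) (proj₂ (at-end₂ b∈))
    where
    at-end₂ : ∀ {a} → a ∈ Z (sucMod i) ∩ adjSet G e → a ∈ R (sucMod i) × Incident G (end₂ G e) a
    at-end₂ {a} a∈ with x∈p∩q⁻ (Z (sucMod i)) (adjSet G e) a∈
    ... | a∈Z , a-adj with ∈-decSubset⁻ (adjacent? G e) a-adj
    ...   | _ , t , inj₁ refl , t∈a = ⊥-elim (Z∌Base i a∈Z
            (∈-touching⁺ G (Z⊆R _ a∈Z) (x∈p∪q⁺ (inj₂ (∈-image⁺ (end₁ G) (Y′⊆B i e∈Y′)))) t∈a))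
    ...   | _ , t , inj₂ refl , t∈a = Z⊆R _ a∈Z , t∈a

  H′-covered : ∀ i → AtLeastCovered G (H′ G X Y Z) X i w
  H′-covered i = S i , w≤∣S∣ i , λ v v∈S →
    let covered-by-X , next = S-covered i v∈S
    in covered-by-X , map₂ (λ no-edge e e∈H′ → no-edge e (subst (e ∈_) (H′≡D _) e∈H′)) next

  partition : 2 * w ≤ 3 * x → IsPartition G X Y Z x w
  partition 2w≤3x =
    ( (λ e → let i , e∈D = D-covers e in
              i , map₂ (x∈p∪q⁻ (Y i) (Z i)) (x∈p∪q⁻ (X i) _ (subst (e ∈_) (sym (H′≡D i)) e∈D)))
    , class-unique X⊆D
    , class-unique Y⊆D
    , class-unique Z⊆D
    , classes-disjoint X⊆D Y⊆D (λ j e∈X e∈Y → x∈p─q⇒x∉q (Y⊆R j e∈Y) e∈X)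
    , classes-disjoint X⊆D Z⊆D (λ j e∈X e∈Z → x∈p─q⇒x∉q (Z⊆R j e∈Z) e∈X)
    , classes-disjoint Y⊆D Z⊆D (λ j e∈Y e∈Z → x∈p─q⇒x∉q e∈Z e∈Y) )
    , (2w≤3x , x+2y≤⌊m/c⌋)
    , equitable-resp-≗ G H′≡D D-equitable
    , (λ i → ∣X∣≡x i , ∣Y∣≡y i)
    , X-Z-nonadjacent
    , (λ i → ≤-trans (*-monoʳ-≤ 3 (p⊆q⇒∣p∣≤∣q∣ (Y′⊆B i))) (proj₂ (∣endpoints─S∣+∣B∣≤y×3∣B∣≤y i)) , Y′-Z-neighbours≤1 i)
    , H′-covered

-- Regularity and the chromatic index are not needed: the construction works for any
-- equitable matching decomposition.
lemma6p1 : (k n m c : ℕ) → 3 ≤ k → (G : Graph n m) → Regular G k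
    → ChromaticIndex G c
    → (D : Fin c → Subset m) → IsEquitableMatchingDecomposition G D
    → (X : Fin c → Subset m) (x w : ℕ) → IsSemipartition G D X x w
    → 2 * w ≤ 3 * x → x + 2 * yOf x w ≤ floorDiv m c
    → Σ (Fin c → Subset m) λ Y → Σ (Fin c → Subset m) λ Z →
        IsPartition G X Y Z x w × (∀ i → H′ G X Y Z i ≡ D i)
lemma6p1 _ n m c _ G _ _ D D-equitable X x w X-semi 2w≤3x x+2y≤⌊m/c⌋ =
  Y , Z , partition 2w≤3x , H′≡D
  where open Construction G D X x w D-equitable X-semi x+2y≤⌊m/c⌋
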